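{- Let $k\ge 2$, let $\sigma$ be a request sequence over a set of pages $U$, let $\mathcal I$ be a $k$-level hierarchical service pattern for $\sigma$, and let $I\in\mathcal I$ be a level-$k$ interval. Let $Q\subseteq U$ be the set of feasible labels for $I$, i.e. the pages $p$ for which some labeling $\alpha$ of $T_I$ with $\alpha(I)=p$ is feasible for $\sigma_I$. Then either $Q=U$, or $|Q|\le n(k,1)$; moreover $n(k,1)\le 2^{2^{k+3\log_2 k}}$.
   Context: Let $U$ be a finite set of pages and $\sigma=\sigma_1,\dots,\sigma_T$ with $\sigma_t\in U$. A ($k$-level, hierarchical) service pattern is $\mathcal I=\mathcal I_1\cup\dots\cup\mathcal I_k$, where each $\mathcal I_i$ (the level-$i$ intervals) is a partition of $[0,T+1)$ into half-open intervals with integer endpoints, such that every level-$i$ interval with $i<k$ is contained in a level-$(i+1)$ interval. The ancestors $A(I)$ of $I$ are the higher-level intervals containing $I$; $T_I$ consists of $I$ and all lower-level intervals contained in $I$; the children of a level-$\ell$ interval are the level-$(\ell-1)$ intervals contained in it. A labeling is a partial map $\alpha$ from intervals to $U$; a labeling of a set $\mathcal J$ of intervals is feasible for $\sigma_I$ (the requests at times $t\in I\cap\{1,\dots,T\}$) if for every such $t$ some $J\in\mathcal J$ with $t\in J$ has $\alpha(J)=\sigma_t$. For a level-$\ell$ interval $I$ with $\ell\ge 2$ and set of children $C$, the joint request list $L(C)$ is the set of inclusion-minimal $S\subseteq U$ with $|S|\le k-\ell+1$ such that some labeling of $T_I\cup A(I)$, feasible for $\sigma_I$, labels each interval of $\{I\}\cup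 A(I)$ either not at all or by an element of $S$. $n(k,1)$ is the supremum, over all finite $U$, all request sequences, all $k$-level hierarchical service patterns and all level-$k$ intervals $I$, of the number of one-element sets in the joint request list of the children of $I$. -}

module Defs where

open import Data.Nat using (ℕ; zero; suc; _+_; _*_; _∸_; _^_; _≤_; _<_)
open import Data.Fin using (Fin; toℕ)
open import Data.Fin.Subset using (Subset; ⁅_⁆; ∣_∣; _⊂_) renaming (_∈_ to _∈ₛ_)
open import Data.Bool using (Bool; true)
open import Data.Maybe using (Maybe; just; nothing)
open import Data.List using (List; length)
open import Data.List.Relation.Unary.All using (All)
open import Data.List.Relation.Unary.Unique.Propositional using (Unique)
open import Data.Product using (Σ; ∃; _×_)
open import Data.Sum using (_⊎_)
open import Relation.Nullary using (¬_)
open import Relation.Binary.PropositionalEquality using (_≡_)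

-- Conventions
--  * The page set U is Fin u (any finite set, up to bijection).
--  * A request sequence σ₁,…,σ_T is a map σ : Fin T → Fin u; the request
--    at time t ∈ {1,…,T} is σ (t-1), i.e. time of index i is suc (toℕ i).
--  * Levels are natural numbers 1,…,k.
--  * A partition of [0,T+1) into half-open intervals with integer endpoints
--    is determined by its set of interior endpoints ⊆ {1,…,T}; a service
--    pattern records, for each level ℓ and position p, whether p is an
--    endpoint of the level-ℓ partition (values outside 1≤ℓ≤k, 1≤p≤T are
--    irrelevant).  Nesting (every level-ℓ interval lies in a level-(ℓ+1)
--    interval) means every level-(ℓ+1) endpoint is a level-ℓ endpoint.

record Pattern (k T : ℕ) : Set where
  field
    cut    : ℕ → ℕ → Bool
    nested : ∀ ℓ p → 1 ≤ ℓ → ℓ < k → cut (suc ℓ) p ≡ true → cut ℓ p ≡ true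
open Pattern public

Boundary : ∀ {k T} → Pattern k T → ℕ → ℕ → Set
Boundary {k} {T} P ℓ p = p ≡ 0 ⊎ p ≡ suc T ⊎ (1 ≤ p × p ≤ T × cut P ℓ p ≡ true)

-- A candidate interval [lo,hi) at a given level (intervals of different
-- levels are distinct objects).
record Interval : Set where
  constructor ⟨_,_,_⟩
  field
    level : ℕ
    lo    : ℕ
    hi    : ℕ
open Interval public

IsInterval : ∀ {k T} → Pattern k T → Interval → Set
IsInterval {k} P J =
  1 ≤ level J × level J ≤ k × lo J < hi J ×
  Boundary P (level J) (lo J) × Boundary P (level J) (hi J) ×
  (∀ p → lo J < p → p < hi J → ¬ Boundary P (level J) p)

_∈ᵢ_ : ℕ → Interval → Set
t ∈ᵢ J = lo J ≤ t × t < hi J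

InT : ∀ {k T} → Pattern k T → Interval → Interval → Set
InT P I J = IsInterval P J × level J ≤ level I × lo I ≤ lo J × hi J ≤ hi I

InA : ∀ {k T} → Pattern k T → Interval → Interval → Set
InA P I J = IsInterval P J × level I < level J × lo J ≤ lo I × hi I ≤ hi J

-- A labeling: partial map from intervals to pages (nothing = unlabeled).
Labeling : ℕ → Set
Labeling u = Interval → Maybe (Fin u)

Feasible : ∀ {u T} → (Fin T → Fin u) → (Interval → Set) → Labeling u → Interval → Set
Feasible {u} {T} σ 𝒥 α I =
  ∀ (i : Fin T) → suc (toℕ i) ∈ᵢ I →
    Σ Interval λ J → 𝒥 J × suc (toℕ i) ∈ᵢ J × α J ≡ just (σ i)

FeasibleLabel : ∀ {k T u} → Pattern k T → (Fin T → Fin u) → Interval → Fin u → Set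
FeasibleLabel P σ I p =
  Σ (Labeling _) λ α → α I ≡ just p × Feasible σ (InT P I) α I

GoodFor : ∀ {k T u} → Pattern k T → (Fin T → Fin u) → Interval → Subset u → Set
GoodFor P σ I S =
  Σ (Labeling _) λ α →
    Feasible σ (λ J → InT P I J ⊎ InA P I J) α I ×
    (∀ J → J ≡ I ⊎ InA P I J →
       α J ≡ nothing ⊎ Σ _ λ p → α J ≡ just p × p ∈ₛ S)

-- S ∈ L(C), C the children of the level-ℓ interval I (ℓ = level I ≥ 2):
-- S is inclusion-minimal among the sets of size ≤ k-ℓ+1 that are GoodFor.
InJointRequestList : ∀ {k T u} → Pattern k T → (Fin T → Fin u) → Interval → Subset u → Set
InJointRequestList {k} P σ I S =
  ∣ S ∣ ≤ k ∸ level I + 1 × GoodFor P σ I S ×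
  (∀ S′ → S′ ⊂ S → ∣ S′ ∣ ≤ k ∸ level I + 1 → ¬ GoodFor P σ I S′)

-- |{ x | Q x }| ≤ N, for a (not necessarily decidable) predicate on a
-- finite type: every duplicate-free list of elements satisfying Q has
-- length ≤ N.
CardLE : ∀ {u} → (Fin u → Set) → ℕ → Set
CardLE {u} Q N = ∀ (xs : List (Fin u)) → Unique xs → All Q xs → length xs ≤ N

-- N is an upper bound for the quantity whose supremum is n(k,1):
-- for all finite U = Fin u, all σ, all k-level service patterns and all
-- level-k intervals I, the number of one-element sets in the joint request
-- list of the children of I is ≤ N.
-- Thus "n(k,1) ≤ N" is exactly  NK1Bound k N.
NK1Bound : ℕ → ℕ → Set
NK1Bound k N =
  ∀ (u T : ℕ) (σ : Fin T → Fin u) (P : Pattern k T) (I : Interval) →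
    IsInterval P I → level I ≡ k →
    CardLE (λ p → InJointRequestList P σ I ⁅ p ⁆) N

-- "m ≤ n(k,1)" (with n(k,1) ∈ ℕ ∪ {∞} a supremum): m ≤ every upper bound.
LeNK1 : ℕ → ℕ → Set
LeNK1 k m = ∀ N → NK1Bound k N → m ≤ N

CardLeNK1 : ∀ {u} → ℕ → (Fin u → Set) → Set
CardLeNK1 k Q = ∀ xs → Unique xs → All Q xs → LeNK1 k (length xs)

-- Call a window of requests, lying inside an interval of level ℓ, servable relative to a
-- list F of pages if its requests can be served by intervals of level < ℓ, except those
-- asking for a page of F (offered by the labels of enclosing intervals). By induction on ℓ,
-- either a window between two level-ℓ boundaries is servable, or already some certSize ℓ
-- of its requests are not. The level-(ℓ+1) window is treated child by child: a child C is
-- servable iff it is servable one level lower once the page of its own label q is offered.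
-- If this fails for every one of the finitely many q, certificates W_q exist for all q,
-- and W_none together with the W_{σ j}, j ∈ W_none, is a certificate for C: to help inside
-- W_none the label of C must be one of the pages σ j.
--
-- For a level-k interval I and F = [] this gives the theorem. If I is servable, every page
-- is a feasible label and ∅ already qualifies, so the joint request list has no singleton.
-- Otherwise ∅ does not qualify, so every feasible label p makes {p} a member of the joint
-- request list; and for every such member, p is requested inside the certificate.

module Submission where

open import Defs
open import Data.Nat using (ℕ; _≤_; _^_; _*_)
open import Data.Fin using (Fin)
open import Data.Product using (_×_)
open import Data.Sum using (_⊎_)
open import Relation.Binary.PropositionalEquality using (_≡_)

open import Data.Nat using (zero; suc; _+_; _<_; z≤n; s≤s; _≟_; _≤?_; _<?_; NonZero; >-nonZero)
open import Data.Nat.Properties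
open import Data.Bool as Bool using ()
open import Data.Fin as F using (toℕ)
open import Data.Fin.Properties using (any?)
open import Data.Fin.Subset using (Subset; ⁅_⁆; _⊂_)
  renaming (_∈_ to _∈ₛ_; _∉_ to _∉ₛ_; ⊥ to ∅)
open import Data.Fin.Subset.Properties using (x∈⁅y⁆⇒x≡y; x∈⁅x⁆; ∣⁅x⁆∣≡1; ⊥⊆; ∉⊥; ∣⊥∣≡0)
open import Data.Unit using (⊤; tt)
open import Data.Maybe using (Maybe; just; nothing)
open import Data.Maybe.Properties using (just-injective)
open import Data.List using (List; []; _∷_; length; _++_; concatMap; map; fromMaybe)
open import Data.List.Properties using (length-++; length-map; length-removeAt′)
open import Data.List.Relation.Unary.All as All using (All; []; _∷_)
open import Data.List.Relation.Unary.Any as Any using (here; there; index)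
open import Data.List.Relation.Unary.AllPairs using (_∷_)
open import Data.List.Relation.Unary.Unique.Propositional using (Unique)
open import Data.List.Membership.Propositional using (_∈_; _─_)
open import Data.List.Membership.Propositional.Properties
  using (∈-++⁺ˡ; ∈-++⁺ʳ; ∈-map⁺; ∈-map⁻; ∈-concatMap⁺)
import Data.List.Membership.DecPropositional as DecMembership
open import Data.Product using (Σ; ∃; _,_; proj₁; proj₂)
open import Data.Sum as Sum using (inj₁; inj₂; [_,_]′)
open import Function using (_∘_)
open import Relation.Nullary using (¬_; Dec; yes; no; contradiction)
open import Relation.Nullary.Decidable using (_×-dec_; _⊎-dec_; decidable-stable)
open import Relation.Unary using (Decidable)
open import Relation.Binary.PropositionalEquality
  using (refl; sym; trans; cong; cong₂; subst; _≢_)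

module _ {A : Set} where

  ∈-─ : ∀ {x y : A} {ys} (x∈ys : x ∈ ys) → y ∈ ys → y ≢ x → y ∈ ys ─ x∈ys
  ∈-─ (here refl)  (here refl)  y≢x = contradiction refl y≢x
  ∈-─ (here _)     (there y∈ys) _   = y∈ys
  ∈-─ (there _)    (here y≡z)   _   = here y≡z
  ∈-─ (there x∈ys) (there y∈ys) y≢x = there (∈-─ x∈ys y∈ys y≢x)

  Unique⇒length≤ : ∀ {xs ys : List A} → Unique xs → All (_∈ ys) xs → length xs ≤ length ys
  Unique⇒length≤ {[]}          _            _              = z≤n
  Unique⇒length≤ {x ∷ xs} {ys} (x≢xs ∷ uxs) (x∈ys ∷ xs⊆ys) = begin
    suc (length xs)          ≤⟨ s≤s (Unique⇒length≤ uxs (All.zipWith keep (xs⊆ys , x≢xs))) ⟩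
    suc (length (ys ─ x∈ys)) ≡⟨ length-removeAt′ ys (index x∈ys) ⟨
    length ys                ∎
    where
    open ≤-Reasoning
    keep : ∀ {y} → y ∈ ys × x ≢ y → y ∈ ys ─ x∈ys
    keep (y∈ys , x≢y) = ∈-─ x∈ys y∈ys (x≢y ∘ sym)

length-concatMap≤ : ∀ {A B : Set} (f : A → List B) {c} xs →
                    (∀ x → length (f x) ≤ c) → length (concatMap f xs) ≤ length xs * c
length-concatMap≤ f []       _   = z≤n
length-concatMap≤ f (x ∷ xs) f≤c rewrite length-++ (f x) {concatMap f xs} =
  +-mono-≤ (f≤c x) (length-concatMap≤ f xs f≤c)

⊂⁅x⁆⇒∉ : ∀ {n} {S : Subset n} {x} → S ⊂ ⁅ x ⁆ → ∀ y → y ∉ₛ S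
⊂⁅x⁆⇒∉ {x = x} (S⊆⁅x⁆ , z , z∈⁅x⁆ , z∉S) y y∈S =
  z∉S (subst (_∈ₛ _) (trans (x∈⁅y⁆⇒x≡y x (S⊆⁅x⁆ y∈S)) (sym (x∈⁅y⁆⇒x≡y x z∈⁅x⁆))) y∈S)

Fin-∃⊎∀ : ∀ {n} {A B : Fin n → Set} → (∀ i → A i ⊎ B i) → ∃ A ⊎ (∀ i → B i)
Fin-∃⊎∀ {zero}  _ = inj₂ λ ()
Fin-∃⊎∀ {suc n} f with f F.zero | Fin-∃⊎∀ (f ∘ F.suc)
... | inj₁ a | _            = inj₁ (F.zero , a)
... | inj₂ _ | inj₁ (i , a) = inj₁ (F.suc i , a)
... | inj₂ b | inj₂ g       = inj₂ λ { F.zero → b ; (F.suc i) → g i }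

Maybe-∃⊎∀ : ∀ {n} {A B : Maybe (Fin n) → Set} → (∀ q → A q ⊎ B q) → ∃ A ⊎ (∀ q → B q)
Maybe-∃⊎∀ f with f nothing | Fin-∃⊎∀ (f ∘ just)
... | inj₁ a | _            = inj₁ (nothing , a)
... | inj₂ _ | inj₁ (i , a) = inj₁ (just i , a)
... | inj₂ b | inj₂ g       = inj₂ λ { nothing → b ; (just i) → g i }

FirstAbove : (ℕ → Set) → ℕ → ℕ → Set
FirstAbove Q a m = a < m × Q m × (∀ p → a < p → p < m → ¬ Q p)

module _ {Q : ℕ → Set} (Q? : Decidable Q) where

  firstAbove? : ∀ a b → (∃ λ m → m ≤ b × FirstAbove Q a m) ⊎ (∀ p → a < p → p ≤ b → ¬ Q p)
  firstAbove? a zero = inj₂ λ _ a<p p≤0 → contradiction (<-≤-trans a<p p≤0) λ ()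
  firstAbove? a (suc b) with firstAbove? a b
  ... | inj₁ (m , m≤b , first) = inj₁ (m , m≤n⇒m≤1+n m≤b , first)
  ... | inj₂ none with a <? suc b | Q? (suc b)
  ...   | yes a<1+b | yes q =
    inj₁ (suc b , ≤-refl , a<1+b , q , λ p a<p p<1+b → none p a<p (≤-pred p<1+b))
  ...   | no a≮1+b  | _     =
    inj₂ λ _ a<p p≤1+b → contradiction (<-≤-trans a<p p≤1+b) a≮1+b
  ...   | yes _     | no ¬q =
    inj₂ λ p a<p p≤1+b → [ none p a<p ∘ ≤-pred , (λ { refl → ¬q }) ]′ (m≤n⇒m<n∨m≡n p≤1+b)

  firstAbove : ∀ {a b} → a < b → Q b → ∃ λ m → m ≤ b × FirstAbove Q a m
  firstAbove {a} {b} a<b qb with firstAbove? a b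
  ... | inj₁ found = found
  ... | inj₂ none  = contradiction qb (none b a<b ≤-refl)

module _ {u : ℕ} where

  relabelLevel : ℕ → Maybe (Fin u) → Labeling u → Labeling u
  relabelLevel ℓ q α J with level J ≟ ℓ
  ... | yes _ = q
  ... | no  _ = α J

  relabelLevel-≡ : ∀ {ℓ q} α J → level J ≡ ℓ → relabelLevel ℓ q α J ≡ q
  relabelLevel-≡ {ℓ} _ J ℓJ≡ℓ with level J ≟ ℓ
  ... | yes _    = refl
  ... | no ℓJ≢ℓ = contradiction ℓJ≡ℓ ℓJ≢ℓ

  relabelLevel-≢ : ∀ {ℓ q α J} → level J ≢ ℓ → relabelLevel ℓ q α J ≡ α J
  relabelLevel-≢ {ℓ} {J = J} ℓJ≢ℓ with level J ≟ ℓ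
  ... | yes ℓJ≡ℓ = contradiction ℓJ≡ℓ ℓJ≢ℓ
  ... | no  _    = refl

  glue : ℕ → Labeling u → Labeling u → Labeling u
  glue m α β J with lo J <? m
  ... | yes _ = α J
  ... | no  _ = β J

  glue-< : ∀ {m α β J} → lo J < m → glue m α β J ≡ α J
  glue-< {m} {J = J} loJ<m with lo J <? m
  ... | yes _    = refl
  ... | no loJ≮m = contradiction loJ<m loJ≮m

  glue-≮ : ∀ {m α β J} → ¬ lo J < m → glue m α β J ≡ β J
  glue-≮ {m} {J = J} loJ≮m with lo J <? m
  ... | yes loJ<m = contradiction loJ<m loJ≮m
  ... | no  _     = refl

module Geometry {k T : ℕ} (P : Pattern k T) where

  boundary? : ∀ ℓ p → Dec (Boundary P ℓ p)
  boundary? ℓ p =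
    p ≟ 0 ⊎-dec p ≟ suc T ⊎-dec 1 ≤? p ×-dec p ≤? T ×-dec cut P ℓ p Bool.≟ Bool.true

  boundary-pred : ∀ {ℓ p} → 1 ≤ ℓ → ℓ < k → Boundary P (suc ℓ) p → Boundary P ℓ p
  boundary-pred _   _   (inj₁ p≡0)                      = inj₁ p≡0
  boundary-pred _   _   (inj₂ (inj₁ p≡1+T))             = inj₂ (inj₁ p≡1+T)
  boundary-pred 1≤ℓ ℓ<k (inj₂ (inj₂ (1≤p , p≤T , cut))) =
    inj₂ (inj₂ (1≤p , p≤T , nested P _ _ 1≤ℓ ℓ<k cut))

  boundary-mono : ∀ {ℓ′ ℓ p} → 1 ≤ ℓ′ → ℓ′ ≤ ℓ → ℓ ≤ k → Boundary P ℓ p → Boundary P ℓ′ p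
  boundary-mono {ℓ = zero}  1≤ℓ′ ℓ′≤0 _ _ = contradiction (≤-trans 1≤ℓ′ ℓ′≤0) λ ()
  boundary-mono {ℓ = suc ℓ} 1≤ℓ′ ℓ′≤1+ℓ 1+ℓ≤k b with m≤n⇒m<n∨m≡n ℓ′≤1+ℓ
  ... | inj₂ refl       = b
  ... | inj₁ (s≤s ℓ′≤ℓ) =
    boundary-mono 1≤ℓ′ ℓ′≤ℓ (<⇒≤ 1+ℓ≤k) (boundary-pred (≤-trans 1≤ℓ′ ℓ′≤ℓ) 1+ℓ≤k b)

  boundary-lo : ∀ {J} → IsInterval P J → Boundary P (level J) (lo J)
  boundary-lo (_ , _ , _ , blo , _ , _) = blo

  boundary-hi : ∀ {J} → IsInterval P J → Boundary P (level J) (hi J)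
  boundary-hi (_ , _ , _ , _ , bhi , _) = bhi

  inside⇒¬boundary : ∀ {J ℓ p} → IsInterval P J → level J ≤ ℓ → ℓ ≤ k →
                     lo J < p → p < hi J → ¬ Boundary P ℓ p
  inside⇒¬boundary (1≤ℓJ , _ , _ , _ , _ , noneInside) ℓJ≤ℓ ℓ≤k loJ<p p<hiJ =
    noneInside _ loJ<p p<hiJ ∘ boundary-mono 1≤ℓJ ℓJ≤ℓ ℓ≤k

  lo-≤ : ∀ {J J′ t} → IsInterval P J → IsInterval P J′ → level J ≡ level J′ →
         t ∈ᵢ J → t ∈ᵢ J′ → lo J′ ≤ lo J
  lo-≤ (_ , _ , _ , _ , _ , noneInsideJ) (_ , _ , _ , bloJ′ , _ , _) ℓJ≡ℓJ′
       (_ , t<hiJ) (loJ′≤t , _) =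
    ≮⇒≥ λ loJ<loJ′ → noneInsideJ _ loJ<loJ′ (≤-<-trans loJ′≤t t<hiJ)
                       (subst (λ ℓ → Boundary P ℓ _) (sym ℓJ≡ℓJ′) bloJ′)

  hi-≤ : ∀ {J J′ t} → IsInterval P J → IsInterval P J′ → level J ≡ level J′ →
         t ∈ᵢ J → t ∈ᵢ J′ → hi J ≤ hi J′
  hi-≤ (_ , _ , _ , _ , _ , noneInsideJ) (_ , _ , _ , _ , bhiJ′ , _) ℓJ≡ℓJ′
       (loJ≤t , _) (_ , t<hiJ′) =
    ≮⇒≥ λ hiJ′<hiJ → noneInsideJ _ (≤-<-trans loJ≤t t<hiJ′) hiJ′<hiJ
                       (subst (λ ℓ → Boundary P ℓ _) (sym ℓJ≡ℓJ′) bhiJ′)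

  interval-unique : ∀ {J J′ t} → IsInterval P J → IsInterval P J′ → level J ≡ level J′ →
                    t ∈ᵢ J → t ∈ᵢ J′ → J ≡ J′
  interval-unique {⟨ ℓ , _ , _ ⟩} {⟨ _ , _ , _ ⟩} iJ iJ′ refl t∈J t∈J′ =
    cong₂ (⟨_,_,_⟩ ℓ) (≤-antisym (lo-≤ iJ′ iJ refl t∈J′ t∈J) (lo-≤ iJ iJ′ refl t∈J t∈J′))
                      (≤-antisym (hi-≤ iJ iJ′ refl t∈J t∈J′) (hi-≤ iJ′ iJ refl t∈J′ t∈J))

  intervalFrom : ∀ {ℓ a b} → 1 ≤ ℓ → ℓ ≤ k → Boundary P ℓ a → a < b → Boundary P ℓ b →
                 ∃ λ m → m ≤ b × IsInterval P ⟨ ℓ , a , m ⟩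
  intervalFrom 1≤ℓ ℓ≤k ba a<b bb with firstAbove (boundary? _) a<b bb
  ... | m , m≤b , a<m , bm , noneInside = m , m≤b , (1≤ℓ , ℓ≤k , a<m , ba , bm , noneInside)

certSize : ℕ → ℕ
certSize zero    = 1
certSize (suc n) = certSize n + certSize n * certSize n

certSize<2^2^ : ∀ n → certSize n < 2 ^ 2 ^ n
certSize<2^2^ zero    = ≤-refl
certSize<2^2^ (suc n) = begin-strict
  c + c * c             <⟨ s≤s (+-monoʳ-≤ c (*-monoʳ-≤ c (n≤1+n c))) ⟩
  suc c * suc c         ≤⟨ *-mono-≤ (certSize<2^2^ n) (certSize<2^2^ n) ⟩
  2 ^ 2 ^ n * 2 ^ 2 ^ n ≡⟨ ^-distribˡ-+-* 2 (2 ^ n) (2 ^ n) ⟨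
  2 ^ (2 ^ n + 2 ^ n)   ≡⟨ cong (λ e → 2 ^ (2 ^ n + e)) (+-identityʳ (2 ^ n)) ⟨
  2 ^ 2 ^ suc n         ∎
  where
  open ≤-Reasoning
  c = certSize n

certSize≤2^[2^k*k^3] : ∀ k .{{_ : NonZero k}} → certSize k ≤ 2 ^ (2 ^ k * k ^ 3)
certSize≤2^[2^k*k^3] k =
  ≤-trans (<⇒≤ (certSize<2^2^ k)) (^-monoʳ-≤ 2 (m≤m*n (2 ^ k) (k ^ 3) {{m^n≢0 k 3}}))

module Serving {k u T : ℕ} (σ : Fin T → Fin u) (P : Pattern k T) where

  open Geometry P
  open DecMembership (F._≟_ {u}) using (_∈?_; _∉?_)

  time : Fin T → ℕ
  time i = suc (toℕ i)

  ServedBelow : ℕ → Labeling u → Fin T → Set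
  ServedBelow ℓ α i =
    Σ Interval λ J → IsInterval P J × level J < ℓ × time i ∈ᵢ J × α J ≡ just (σ i)

  Servable : (Fin T → Set) → ℕ → ℕ → ℕ → List (Fin u) → Set
  Servable R ℓ a b F = Σ (Labeling u) λ α →
    ∀ i → a ≤ time i → time i < b → R i → σ i ∈ F ⊎ ServedBelow ℓ α i

  Certificate : ℕ → ℕ → ℕ → List (Fin u) → Set
  Certificate ℓ a b F =
    Σ (List (Fin T)) λ W → length W ≤ certSize ℓ × ¬ Servable (_∈ W) ℓ a b F

  Dichotomy : ℕ → ℕ → ℕ → List (Fin u) → Set
  Dichotomy ℓ a b F = Servable (λ _ → ⊤) ℓ a b F ⊎ Certificate ℓ a b F

  servedBelow-agree : ∀ {ℓ α β i} →
                      (∀ {J} → IsInterval P J → level J < ℓ → time i ∈ᵢ J → α J ≡ β J) →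
                      ServedBelow ℓ α i → ServedBelow ℓ β i
  servedBelow-agree α≡β (J , iJ , ℓJ<ℓ , t∈J , αJ) =
    J , iJ , ℓJ<ℓ , t∈J , trans (sym (α≡β iJ ℓJ<ℓ t∈J)) αJ

  servedBelow-suc : ∀ {ℓ α i} → ServedBelow ℓ α i → ServedBelow (suc ℓ) α i
  servedBelow-suc (J , iJ , ℓJ<ℓ , t∈J , αJ) = J , iJ , m<n⇒m<1+n ℓJ<ℓ , t∈J , αJ

  ¬servedBelow-1 : ∀ {α i} → ¬ ServedBelow 1 α i
  ¬servedBelow-1 (_ , (1≤ℓJ , _) , ℓJ<1 , _) = <-irrefl refl (≤-<-trans 1≤ℓJ ℓJ<1)

  servable-⊆ : ∀ {R R′ ℓ a b F} → (∀ {i} → R′ i → R i) →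
               Servable R ℓ a b F → Servable R′ ℓ a b F
  servable-⊆ R′⊆R (α , serve) = α , λ i a≤t t<b r′ → serve i a≤t t<b (R′⊆R r′)

  servable-window : ∀ {R ℓ a b a′ b′ F} → a ≤ a′ → b′ ≤ b →
                    Servable R ℓ a b F → Servable R ℓ a′ b′ F
  servable-window a≤a′ b′≤b (α , serve) =
    α , λ i a′≤t t<b′ → serve i (≤-trans a≤a′ a′≤t) (<-≤-trans t<b′ b′≤b)

  servable-empty : ∀ {R ℓ a b F} → b ≤ a → Servable R ℓ a b F
  servable-empty b≤a =
    (λ _ → nothing) , λ _ a≤t t<b _ → contradiction b≤a (<⇒≱ (≤-<-trans a≤t t<b))

  servable-drop : ∀ {R ℓ a b F p} → (∀ {i} → R i → σ i ≢ p) →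
                  Servable R ℓ a b (p ∷ F) → Servable R ℓ a b F
  servable-drop σ≢p (α , serve) =
    α , λ i a≤t t<b r → Sum.map₁ (drop (σ≢p r)) (serve i a≤t t<b r)
    where
    drop : ∀ {x p F} → x ≢ p → x ∈ p ∷ F → x ∈ F
    drop x≢p (here x≡p)  = contradiction x≡p x≢p
    drop _   (there x∈F) = x∈F

  servable-join : ∀ {R ℓ a m b F} → ℓ ≤ k → Boundary P ℓ m →
                  Servable R (suc ℓ) a m F → Servable R (suc ℓ) m b F → Servable R (suc ℓ) a b F
  servable-join {R} {ℓ} {a} {m} {b} {F} ℓ≤k bm (α , serveˡ) (β , serveʳ) = glue m α β , serve
    where
    serve : ∀ i → a ≤ time i → time i < b → R i →
            σ i ∈ F ⊎ ServedBelow (suc ℓ) (glue m α β) i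
    serve i a≤t t<b r with time i <? m
    ... | yes t<m =
      Sum.map₂ (servedBelow-agree λ _ _ (loJ≤t , _) → sym (glue-< (≤-<-trans loJ≤t t<m)))
               (serveˡ i a≤t t<m r)
    ... | no  t≮m =
      Sum.map₂ (servedBelow-agree λ iJ ℓJ<1+ℓ (_ , t<hiJ) → sym (glue-≮ λ loJ<m →
                  inside⇒¬boundary iJ (≤-pred ℓJ<1+ℓ) ℓ≤k loJ<m (≤-<-trans (≮⇒≥ t≮m) t<hiJ) bm))
               (serveʳ i (≮⇒≥ t≮m) t<b r)

  label⇒servable : ∀ {R ℓ a m F} → IsInterval P ⟨ ℓ , a , m ⟩ → ∀ q →
                   Servable R ℓ a m (fromMaybe q ++ F) → Servable R (suc ℓ) a m F
  label⇒servable {R} {ℓ} {a} {m} {F} iC q (α , serve) =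
    relabelLevel ℓ q α , λ i a≤t t<m r → lift q i a≤t t<m (serve i a≤t t<m r)
    where
    lift : ∀ q i → a ≤ time i → time i < m → σ i ∈ fromMaybe q ++ F ⊎ ServedBelow ℓ α i →
           σ i ∈ F ⊎ ServedBelow (suc ℓ) (relabelLevel ℓ q α) i
    lift nothing  _ _   _   (inj₁ σi∈F)         = inj₁ σi∈F
    lift (just _) _ _   _   (inj₁ (there σi∈F)) = inj₁ σi∈F
    lift (just _) _ a≤t t<m (inj₁ (here refl))  =
      inj₂ (⟨ ℓ , a , m ⟩ , iC , ≤-refl , (a≤t , t<m) , relabelLevel-≡ α ⟨ ℓ , a , m ⟩ refl)
    lift q        _ _   _   (inj₂ served)       =
      inj₂ (servedBelow-suc
             (servedBelow-agree (λ _ ℓJ<ℓ _ → sym (relabelLevel-≢ (<⇒≢ ℓJ<ℓ))) served))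

  servable⇒label : ∀ {R ℓ a m F} → IsInterval P ⟨ ℓ , a , m ⟩ →
                   Servable R (suc ℓ) a m F → ∃ λ q → Servable R ℓ a m (fromMaybe q ++ F)
  servable⇒label {R} {ℓ} {a} {m} {F} iC (α , serve) =
    α C , α , λ i a≤t t<m r → lower i a≤t t<m (serve i a≤t t<m r)
    where
    C = ⟨ ℓ , a , m ⟩
    lower : ∀ i → a ≤ time i → time i < m → σ i ∈ F ⊎ ServedBelow (suc ℓ) α i →
            σ i ∈ fromMaybe (α C) ++ F ⊎ ServedBelow ℓ α i
    lower _ _ _ (inj₁ σi∈F) = inj₁ (∈-++⁺ʳ (fromMaybe (α C)) σi∈F)
    lower i a≤t t<m (inj₂ (J , iJ , ℓJ<1+ℓ , t∈J , αJ)) with m≤n⇒m<n∨m≡n (≤-pred ℓJ<1+ℓ)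
    ... | inj₁ ℓJ<ℓ = inj₂ (J , iJ , ℓJ<ℓ , t∈J , αJ)
    ... | inj₂ ℓJ≡ℓ with interval-unique iJ iC ℓJ≡ℓ t∈J (a≤t , t<m)
    ...   | refl rewrite αJ = inj₁ (here refl)

  certificate-window : ∀ {ℓ a b a′ b′ F} → a ≤ a′ → b′ ≤ b →
                       Certificate ℓ a′ b′ F → Certificate ℓ a b F
  certificate-window a≤a′ b′≤b (W , |W|≤ , ¬servable) =
    W , |W|≤ , ¬servable ∘ servable-window a≤a′ b′≤b

  certificate-label : ∀ {ℓ a m F} → IsInterval P ⟨ ℓ , a , m ⟩ →
                      (∀ q → Certificate ℓ a m (fromMaybe q ++ F)) → Certificate (suc ℓ) a m F
  certificate-label {ℓ} {a} {m} {F} iC cert = W₀ ++ concatMap Wₚ W₀ , |W₀++Wₚ|≤ , ¬servable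
    where
    W : Maybe (Fin u) → List (Fin T)
    W q = proj₁ (cert q)
    |W|≤ : ∀ q → length (W q) ≤ certSize ℓ
    |W|≤ q = proj₁ (proj₂ (cert q))
    ¬servableW : ∀ q → ¬ Servable (_∈ W q) ℓ a m (fromMaybe q ++ F)
    ¬servableW q = proj₂ (proj₂ (cert q))

    W₀ = W nothing
    Wₚ : Fin T → List (Fin T)
    Wₚ j = W (just (σ j))

    |W₀++Wₚ|≤ : length (W₀ ++ concatMap Wₚ W₀) ≤ certSize (suc ℓ)
    |W₀++Wₚ|≤ = begin
      length (W₀ ++ concatMap Wₚ W₀)       ≡⟨ length-++ W₀ ⟩
      length W₀ + length (concatMap Wₚ W₀) ≤⟨ +-monoʳ-≤ (length W₀)
                                                 (length-concatMap≤ Wₚ W₀ (|W|≤ ∘ just ∘ σ)) ⟩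
      length W₀ + length W₀ * c            ≤⟨ +-mono-≤ (|W|≤ nothing) (*-monoˡ-≤ c (|W|≤ nothing)) ⟩
      c + c * c                            ∎
      where
      open ≤-Reasoning
      c = certSize ℓ

    ¬servable : ¬ Servable (_∈ W₀ ++ concatMap Wₚ W₀) (suc ℓ) a m F
    ¬servable servable with servable⇒label iC servable
    ... | nothing , s = ¬servableW nothing (servable-⊆ ∈-++⁺ˡ s)
    ... | just p  , s with p ∈? map σ W₀
    ...   | no p∉σW₀ = ¬servableW nothing (servable-drop σ≢p (servable-⊆ ∈-++⁺ˡ s))
      where
      σ≢p : ∀ {j} → j ∈ W₀ → σ j ≢ p
      σ≢p j∈W₀ σj≡p = p∉σW₀ (subst (_∈ map σ W₀) σj≡p (∈-map⁺ σ j∈W₀))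
    ...   | yes p∈σW₀ with ∈-map⁻ σ p∈σW₀
    ...     | j , j∈W₀ , refl = ¬servableW (just (σ j)) (servable-⊆ Wⱼ⊆ s)
      where
      Wⱼ⊆ : ∀ {i} → i ∈ Wₚ j → i ∈ W₀ ++ concatMap Wₚ W₀
      Wⱼ⊆ i∈Wⱼ = ∈-++⁺ʳ W₀ (∈-concatMap⁺ Wₚ (Any.map (λ { refl → i∈Wⱼ }) j∈W₀))

  dichotomy-1 : ∀ a b F → Dichotomy 1 a b F
  dichotomy-1 a b F with any? (λ i → a ≤? time i ×-dec time i <? b ×-dec σ i ∉? F)
  ... | yes (i , a≤t , t<b , σi∉F) =
    inj₂ (i ∷ [] , s≤s z≤n , λ (_ , serve) →
      [ σi∉F , ¬servedBelow-1 ]′ (serve i a≤t t<b (here refl)))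
  ... | no ¬unserved =
    inj₁ ((λ _ → nothing) , λ i a≤t t<b _ →
      inj₁ (decidable-stable (σ i ∈? F) λ σi∉F → ¬unserved (i , a≤t , t<b , σi∉F)))

  dichotomy-label : ∀ {ℓ a m F} → IsInterval P ⟨ ℓ , a , m ⟩ →
                    (∀ q → Dichotomy ℓ a m (fromMaybe q ++ F)) → Dichotomy (suc ℓ) a m F
  dichotomy-label iC dichotomies with Maybe-∃⊎∀ dichotomies
  ... | inj₁ (q , servable) = inj₁ (label⇒servable iC q servable)
  ... | inj₂ certificates   = inj₂ (certificate-label iC certificates)

  dichotomy-join : ∀ {ℓ a m b F} → ℓ ≤ k → Boundary P ℓ m → a ≤ m → m ≤ b →
                   Dichotomy (suc ℓ) a m F → Dichotomy (suc ℓ) m b F → Dichotomy (suc ℓ) a b F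
  dichotomy-join ℓ≤k bm _   _   (inj₁ servableˡ) (inj₁ servableʳ) =
    inj₁ (servable-join ℓ≤k bm servableˡ servableʳ)
  dichotomy-join _   _  _   m≤b (inj₂ certificate) _ =
    inj₂ (certificate-window ≤-refl m≤b certificate)
  dichotomy-join _   _  a≤m _   (inj₁ _) (inj₂ certificate) =
    inj₂ (certificate-window a≤m ≤-refl certificate)

  dichotomy-children : ∀ {ℓ} → 1 ≤ ℓ → ℓ < k →
    (∀ {a m} F → Boundary P ℓ a → Boundary P ℓ m → Dichotomy ℓ a m F) →
    ∀ {a b} F → Boundary P ℓ a → Boundary P ℓ b → Dichotomy (suc ℓ) a b F
  dichotomy-children {ℓ} 1≤ℓ ℓ<k children {a} {b} F ba bb = go b a (m≤n+m b a) ba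
    where
    go : ∀ n a → b ≤ a + n → Boundary P ℓ a → Dichotomy (suc ℓ) a b F
    go n a b≤a+n ba with b ≤? a
    ... | yes b≤a = inj₁ (servable-empty b≤a)
    go zero    a b≤a+0   _  | no b≰a = contradiction (subst (b ≤_) (+-identityʳ a) b≤a+0) b≰a
    go (suc n) a b≤a+1+n ba | no b≰a with intervalFrom 1≤ℓ (<⇒≤ ℓ<k) ba (≰⇒> b≰a) bb
    ... | m , m≤b , iC@(_ , _ , a<m , _ , bm , _) =
      dichotomy-join (<⇒≤ ℓ<k) bm (<⇒≤ a<m) m≤b
        (dichotomy-label iC λ q → children (fromMaybe q ++ F) ba bm)
        (go n m (≤-trans b≤a+1+n (≤-trans (≤-reflexive (+-suc a n)) (+-monoˡ-≤ n a<m))) bm)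

  dichotomy : ∀ ℓ → 1 ≤ ℓ → ℓ ≤ k → ∀ {a b} F →
              Boundary P ℓ a → Boundary P ℓ b → Dichotomy ℓ a b F
  dichotomy 1             _ _     F _  _  = dichotomy-1 _ _ F
  dichotomy (suc (suc ℓ)) _ 2+ℓ≤k F ba bb =
    dichotomy-children (s≤s z≤n) 2+ℓ≤k (dichotomy (suc ℓ) (s≤s z≤n) (<⇒≤ 2+ℓ≤k)) F
      (boundary-pred (s≤s z≤n) 2+ℓ≤k ba) (boundary-pred (s≤s z≤n) 2+ℓ≤k bb)

module TopInterval {k u T : ℕ} (σ : Fin T → Fin u) (P : Pattern k T)
                   {a b : ℕ} (isI : IsInterval P ⟨ k , a , b ⟩) where

  open Geometry P
  open Serving σ P
  open DecMembership (F._≟_ {u}) using (_∈?_)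

  I : Interval
  I = ⟨ k , a , b ⟩

  ¬ancestor : ∀ {J} → ¬ InA P I J
  ¬ancestor ((_ , ℓJ≤k , _) , k<ℓJ , _) = <⇒≱ k<ℓJ ℓJ≤k

  ∈ᵢI⇒⊆I : ∀ {J t} → IsInterval P J → level J ≤ k → t ∈ᵢ J → t ∈ᵢ I → a ≤ lo J × hi J ≤ b
  ∈ᵢI⇒⊆I iJ ℓJ≤k (loJ≤t , t<hiJ) (a≤t , t<b) =
    ≮⇒≥ (λ loJ<a → inside⇒¬boundary iJ ℓJ≤k ≤-refl loJ<a (≤-<-trans a≤t t<hiJ) (boundary-lo isI)) ,
    ≮⇒≥ (λ b<hiJ → inside⇒¬boundary iJ ℓJ≤k ≤-refl (≤-<-trans loJ≤t t<b) b<hiJ (boundary-hi isI))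

  TopServable : Set
  TopServable = Servable (λ _ → ⊤) k a b []

  servable⇒feasible : TopServable → ∀ q →
                      Σ (Labeling u) λ α → α I ≡ q × Feasible σ (InT P I) α I
  servable⇒feasible (α , serve) q = relabelLevel k q α , relabelLevel-≡ α I refl , feasible
    where
    feasible : Feasible σ (InT P I) (relabelLevel k q α) I
    feasible i t∈I with serve i (proj₁ t∈I) (proj₂ t∈I) tt
    ... | inj₂ (J , iJ , ℓJ<k , t∈J , αJ) =
      J , (iJ , <⇒≤ ℓJ<k , ∈ᵢI⇒⊆I iJ (<⇒≤ ℓJ<k) t∈J t∈I) , t∈J ,
      trans (relabelLevel-≢ (<⇒≢ ℓJ<k)) αJ

  feasible⇒goodFor : ∀ {α S} → Feasible σ (InT P I) α I →
                     α I ≡ nothing ⊎ (∃ λ p → α I ≡ just p × p ∈ₛ S) → GoodFor P σ I S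
  feasible⇒goodFor {α} {S} feasible αI = α , feasibleTA , labelled
    where
    feasibleTA : Feasible σ (λ J → InT P I J ⊎ InA P I J) α I
    feasibleTA i t∈I = let J , J∈T , t∈J , αJ = feasible i t∈I in J , inj₁ J∈T , t∈J , αJ
    labelled : ∀ J → J ≡ I ⊎ InA P I J → α J ≡ nothing ⊎ (∃ λ p → α J ≡ just p × p ∈ₛ S)
    labelled _ (inj₁ refl) = αI
    labelled _ (inj₂ J∈A)  = contradiction J∈A ¬ancestor

  goodFor⇒servable : ∀ {S} → GoodFor P σ I S → Servable (λ i → σ i ∉ₛ S) k a b []
  goodFor⇒servable {S} (α , feasible , labelled) = α , serve
    where
    serve : ∀ i → a ≤ time i → time i < b → σ i ∉ₛ S → σ i ∈ [] ⊎ ServedBelow k α i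
    serve i a≤t t<b σi∉S with feasible i (a≤t , t<b)
    ... | J , inj₂ J∈A , _ = contradiction J∈A ¬ancestor
    ... | J , inj₁ (iJ , ℓJ≤k , _) , t∈J , αJ with m≤n⇒m<n∨m≡n ℓJ≤k
    ...   | inj₁ ℓJ<k = inj₂ (J , iJ , ℓJ<k , t∈J , αJ)
    ...   | inj₂ ℓJ≡k with interval-unique iJ isI ℓJ≡k t∈J (a≤t , t<b) | labelled I (inj₁ refl)
    ...     | refl | inj₁ αI≡nothing       = contradiction (trans (sym αJ) αI≡nothing) λ ()
    ...     | refl | inj₂ (p , αI≡p , p∈S) =
      contradiction (subst (_∈ₛ S) (just-injective (trans (sym αI≡p) αJ)) p∈S) σi∉S

  ¬servable⇒jrl : ¬ TopServable →
                  ∀ {p} → FeasibleLabel P σ I p → InJointRequestList P σ I ⁅ p ⁆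
  ¬servable⇒jrl ¬servable {p} (α , αI , feasible) =
    ≤-reflexive (trans (∣⁅x⁆∣≡1 p) (cong (_+ 1) (sym (n∸n≡0 k)))) ,
    feasible⇒goodFor feasible (inj₂ (p , αI , x∈⁅x⁆ p)) ,
    λ S′ S′⊂⁅p⁆ _ good → ¬servable (servable-⊆ (λ _ → ⊂⁅x⁆⇒∉ S′⊂⁅p⁆ _) (goodFor⇒servable good))

  servable⇒¬jrl : TopServable → ∀ {p} → ¬ InJointRequestList P σ I ⁅ p ⁆
  servable⇒¬jrl servable {p} (_ , _ , minimal) with servable⇒feasible servable nothing
  ... | _ , αI , feasible =
    minimal ∅ (⊥⊆ , p , x∈⁅x⁆ p , ∉⊥) (subst (_≤ _) (sym (∣⊥∣≡0 u)) z≤n)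
      (feasible⇒goodFor feasible (inj₁ αI))

  certificate⇒jrl-requested : ∀ {W} → ¬ Servable (_∈ W) k a b [] →
                              ∀ {p} → InJointRequestList P σ I ⁅ p ⁆ → p ∈ map σ W
  certificate⇒jrl-requested {W} ¬servable {p} (_ , good , _) with p ∈? map σ W
  ... | yes p∈σW = p∈σW
  ... | no  p∉σW = contradiction (servable-⊆ requested⇒∉ (goodFor⇒servable good)) ¬servable
    where
    requested⇒∉ : ∀ {j} → j ∈ W → σ j ∉ₛ ⁅ p ⁆
    requested⇒∉ j∈W σj∈⁅p⁆ = p∉σW (subst (_∈ map σ W) (x∈⁅y⁆⇒x≡y p σj∈⁅p⁆) (∈-map⁺ σ j∈W))

  top-dichotomy : Dichotomy k a b []
  top-dichotomy = dichotomy k (proj₁ isI) ≤-refl [] (boundary-lo isI) (boundary-hi isI)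

  feasible-all⊎jrl : (∀ p → FeasibleLabel P σ I p) ⊎
                     (∀ {p} → FeasibleLabel P σ I p → InJointRequestList P σ I ⁅ p ⁆)
  feasible-all⊎jrl with top-dichotomy
  ... | inj₁ servable             = inj₁ λ p → servable⇒feasible servable (just p)
  ... | inj₂ (_ , _ , ¬servableW) = inj₂ (¬servable⇒jrl (¬servableW ∘ servable-⊆ λ _ → tt))

  jrl-card : CardLE (λ p → InJointRequestList P σ I ⁅ p ⁆) (certSize k)
  jrl-card xs unique jrls with top-dichotomy
  jrl-card []      _ _         | inj₁ _        = z≤n
  jrl-card (_ ∷ _) _ (jrl ∷ _) | inj₁ servable = contradiction jrl (servable⇒¬jrl servable)
  jrl-card xs unique jrls      | inj₂ (W , |W|≤ , ¬servable) = begin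
    length xs        ≤⟨ Unique⇒length≤ unique (All.map (certificate⇒jrl-requested ¬servable) jrls) ⟩
    length (map σ W) ≡⟨ length-map σ W ⟩
    length W         ≤⟨ |W|≤ ⟩
    certSize k       ∎
    where open ≤-Reasoning

theorem5 : ∀ (k : ℕ) → 2 ≤ k →
    ∀ (u T : ℕ) (σ : Fin T → Fin u) (P : Pattern k T) (I : Interval) →
    IsInterval P I → level I ≡ k →
    ((∀ p → FeasibleLabel P σ I p) ⊎ CardLeNK1 k (FeasibleLabel P σ I)) ×
    NK1Bound k (2 ^ (2 ^ k * k ^ 3))
theorem5 k _ u T σ P I@(⟨ _ , _ , _ ⟩) isI refl =
  Sum.map₂ boundedByNK1 (TopInterval.feasible-all⊎jrl σ P isI) , nk1Bound
  where
  boundedByNK1 : (∀ {p} → FeasibleLabel P σ I p → InJointRequestList P σ I ⁅ p ⁆) →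
                 CardLeNK1 k (FeasibleLabel P σ I)
  boundedByNK1 feasible⇒jrl xs unique feasible _ bound =
    bound u T σ P I isI refl xs unique (All.map feasible⇒jrl feasible)

  nk1Bound : NK1Bound k (2 ^ (2 ^ k * k ^ 3))
  nk1Bound _ _ σ′ P′ ⟨ _ , _ , _ ⟩ isI′ refl xs unique jrls =
    ≤-trans (TopInterval.jrl-card σ′ P′ isI′ xs unique jrls)
            (certSize≤2^[2^k*k^3] k {{>-nonZero (proj₁ isI)}})
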